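{- In the $F_3$ Black Hole Zeckendorf game, for all $\alpha,\beta\in\mathbb{Z}_{\ge0}$ the positions $(3\alpha,1)$ and $(1,3\beta)$ are both $P$ positions.
   Context: The $F_3$ Black Hole Zeckendorf game: a position is a pair $(a,b)$ of nonnegative integers, the numbers of pieces in the columns of weight $F_1=1$ and $F_2=2$. Two players alternate moves; the available moves are: (merge) if $a\ge 2$, go to $(a-2,b+1)$; (add) if $a\ge1,b\ge1$, go to $(a-1,b-1)$; (split) if $b\ge 2$, go to $(a+1,b-2)$ (pieces landing in column $F_3$, the "black hole", are removed). The player making the last move wins. A position is a $P$ position if the player to move from it loses under optimal play, and an $N$ position if the player to move can force a win; positions with no move are $P$ positions. -}

module Defs where

open import Data.Nat using (ℕ; suc; _+_)
open import Data.Product using (_×_; _,_; ∃)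

-- A position (a , b): a pieces in column F₁ = 1, b pieces in column F₂ = 2.
Position : Set
Position = ℕ × ℕ

data Move : Position → Position → Set where
  merge : ∀ a b → Move (suc (suc a) , b) (a , suc b)
  add   : ∀ a b → Move (suc a , suc b) (a , b)
  split : ∀ a b → Move (a , suc (suc b)) (suc a , b)

-- Normal play (last mover wins).  The game always terminates (a + b strictly
-- decreases), so P/N positions are given by the usual mutual inductive definition:
-- P: every move leads to an N position (vacuously true if no move exists);
-- N: some move leads to a P position.
data IsP : Position → Set
data IsN : Position → Set

data IsP where
  isP : ∀ {x} → (∀ y → Move x y → IsN y) → IsP x

data IsN where
  isN : ∀ {x} y → Move x y → IsP y → IsN x

{-# OPTIONS --safe #-}
-- Modulo 3 every move shifts both coordinates by +1 (merge, split) or by −1 (add).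
-- The positions with residues (0,0), (0,1), (1,0) therefore form a kernel of the
-- game graph: no move joins two of them, since these residue pairs are not
-- diagonal shifts of one another, and every other position has a move into them
-- (checked on coordinates below 3, then transported by translations by multiples
-- of 3).  As the game terminates, the kernel is exactly the set of P positions.
module Submission where

open import Defs
open import Data.Nat using (ℕ; suc; _+_; _*_; _≤_; _<_; z≤n; s≤s)
open import Data.Nat.Properties using (+-suc; *-comm; ≤-refl; +-monoʳ-≤; n≤1+n; ≤-reflexive; <⇒≱)
open import Data.Nat.Induction using (<-wellFounded)
open import Data.Nat.DivMod using (_%_; _/_; m%n<n; m%n%n≡m%n; [m+kn]%n≡m%n; m≡m%n+[m/n]*n; %-distribˡ-+; m*n%n≡0)
open import Data.Product using (_×_; _,_; proj₁; proj₂; ∃-syntax)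
open import Data.Sum using (_⊎_; inj₁; inj₂)
open import Data.Empty using (⊥-elim)
open import Function using (flip; _∘_)
open import Induction.WellFounded using (WellFounded; Acc; acc; module Subrelation)
open import Relation.Binary.Construct.On as On using ()
open import Relation.Binary.PropositionalEquality using (_≡_; refl; sym; trans; cong; cong₂; subst; subst₂)
open import Relation.Nullary using (¬_)

size : Position → ℕ
size (a , b) = a + b

move-decreases-size : ∀ {x y} → Move x y → size y < size x
move-decreases-size (merge a b) = ≤-reflexive (cong suc (+-suc a b))
move-decreases-size (add a b)   = s≤s (+-monoʳ-≤ a (n≤1+n b))
move-decreases-size (split a b) =
  ≤-reflexive (sym (trans (+-suc a (suc b)) (cong suc (+-suc a b))))

Move-wellFounded : WellFounded (flip Move)
Move-wellFounded =
  Subrelation.wellFounded move-decreases-size (On.wellFounded size <-wellFounded)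

module Kernel
  (K : Position → Set)
  (K-independent : ∀ {x y} → Move x y → K x → ¬ K y)
  (K-absorbing : ∀ {x} → ¬ K x → ∃[ y ] Move x y × K y)
  where

  classify : ∀ {x} → Acc (flip Move) x → (K x → IsP x) × (¬ K x → IsN x)
  classify {x} (acc rs) = in-K⇒IsP , not-in-K⇒IsN
    where
    in-K⇒IsP : K x → IsP x
    in-K⇒IsP kx = isP λ y m → proj₂ (classify (rs m)) (K-independent m kx)
    not-in-K⇒IsN : ¬ K x → IsN x
    not-in-K⇒IsN ¬kx with K-absorbing ¬kx
    ... | y , m , ky = isN y m (proj₁ (classify (rs m)) ky)

  K⇒IsP : ∀ {x} → K x → IsP x
  K⇒IsP {x} = proj₁ (classify (Move-wellFounded x))

Cold : Position → Set
Cold (a , b) = a % 3 + b % 3 ≤ 1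

DiagonalStep₃ : Position → Position → Set
DiagonalStep₃ (a , b) (c , d) = suc a % 3 ≡ c % 3 × suc b % 3 ≡ d % 3

move-shifts-residues : ∀ {x y} → Move x y → DiagonalStep₃ x y ⊎ DiagonalStep₃ y x
move-shifts-residues (merge a b) = inj₁ (refl , refl)
move-shifts-residues (add a b)   = inj₂ (refl , refl)
move-shifts-residues (split a b) = inj₁ (refl , refl)

cold-residues-shifted-warm : ∀ r s → r + s ≤ 1 → 1 < suc r % 3 + suc s % 3
cold-residues-shifted-warm 0 0 _ = s≤s (s≤s z≤n)
cold-residues-shifted-warm 0 1 _ = s≤s (s≤s z≤n)
cold-residues-shifted-warm 1 0 _ = s≤s (s≤s z≤n)
cold-residues-shifted-warm 0 (suc (suc _)) (s≤s ())
cold-residues-shifted-warm 1 (suc _) (s≤s ())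
cold-residues-shifted-warm (suc (suc _)) _ (s≤s ())

suc-%3 : ∀ n → suc (n % 3) % 3 ≡ suc n % 3
suc-%3 n = sym (%-distribˡ-+ 1 n 3)

Cold-DiagonalStep₃ : ∀ {x y} → DiagonalStep₃ x y → Cold x → ¬ Cold y
Cold-DiagonalStep₃ {a , b} (a+1≡c , b+1≡d) cold-x = <⇒≱
  (subst₂ (λ u v → 1 < u + v) (trans (suc-%3 a) a+1≡c) (trans (suc-%3 b) b+1≡d)
    (cold-residues-shifted-warm (a % 3) (b % 3) cold-x))

Cold-independent : ∀ {x y} → Move x y → Cold x → ¬ Cold y
Cold-independent {x} {y} m cold-x cold-y with move-shifts-residues m
... | inj₁ x↗y = Cold-DiagonalStep₃ {x} {y} x↗y cold-x cold-y
... | inj₂ y↗x = Cold-DiagonalStep₃ {y} {x} y↗x cold-y cold-x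

Move-translate : ∀ {a b c d} k l → Move (a , b) (c , d) → Move (a + k , b + l) (c + k , d + l)
Move-translate k l (merge a b) = merge (a + k) (b + l)
Move-translate k l (add a b)   = add (a + k) (b + l)
Move-translate k l (split a b) = split (a + k) (b + l)

Cold-translate : ∀ {a b} i j → Cold (a , b) → Cold (a + i * 3 , b + j * 3)
Cold-translate {a} {b} i j =
  subst₂ (λ u v → u + v ≤ 1) (sym ([m+kn]%n≡m%n a i 3)) (sym ([m+kn]%n≡m%n b j 3))

Cold-residues : ∀ {a b} → Cold (a % 3 , b % 3) → Cold (a , b)
Cold-residues {a} {b} = subst₂ (λ u v → u + v ≤ 1) (m%n%n≡m%n a 3) (m%n%n≡m%n b 3)

warm-residues-have-cold-move : ∀ {r s} → r < 3 → s < 3 → ¬ Cold (r , s) →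
                               ∃[ y ] Move (r , s) y × Cold y
warm-residues-have-cold-move {0} {0} _ _ warm = ⊥-elim (warm z≤n)
warm-residues-have-cold-move {0} {1} _ _ warm = ⊥-elim (warm (s≤s z≤n))
warm-residues-have-cold-move {1} {0} _ _ warm = ⊥-elim (warm (s≤s z≤n))
warm-residues-have-cold-move {0} {2} _ _ _ = _ , split 0 0 , s≤s z≤n
warm-residues-have-cold-move {1} {1} _ _ _ = _ , add 0 0 , z≤n
warm-residues-have-cold-move {1} {2} _ _ _ = _ , add 0 1 , s≤s z≤n
warm-residues-have-cold-move {2} {0} _ _ _ = _ , merge 0 0 , s≤s z≤n
warm-residues-have-cold-move {2} {1} _ _ _ = _ , add 1 0 , s≤s z≤n
warm-residues-have-cold-move {2} {2} _ _ _ = _ , merge 0 2 , z≤n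
warm-residues-have-cold-move {suc (suc (suc _))} (s≤s (s≤s (s≤s ()))) _ _
warm-residues-have-cold-move {_} {suc (suc (suc _))} _ (s≤s (s≤s (s≤s ()))) _

Cold-absorbing : ∀ {x} → ¬ Cold x → ∃[ y ] Move x y × Cold y
Cold-absorbing {a , b} warm
  with warm-residues-have-cold-move (m%n<n a 3) (m%n<n b 3) (warm ∘ Cold-residues {a} {b})
... | (c , d) , m , cold = y , subst (λ x → Move x y) a,b-decomposed (Move-translate i j m) ,
                            Cold-translate {c} {d} (a / 3) (b / 3) cold
  where
  i j : ℕ
  i = a / 3 * 3
  j = b / 3 * 3
  y : Position
  y = (c + i , d + j)
  a,b-decomposed : (a % 3 + i , b % 3 + j) ≡ (a , b)
  a,b-decomposed = sym (cong₂ _,_ (m≡m%n+[m/n]*n a 3) (m≡m%n+[m/n]*n b 3))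

open Kernel Cold Cold-independent Cold-absorbing using (K⇒IsP)

corollary4p3 : ∀ (α β : ℕ) → IsP (3 * α , 1) × IsP (1 , 3 * β)
corollary4p3 α β =
  K⇒IsP {3 * α , 1} (subst (λ u → u + 1 ≤ 1) (sym (3*n%3≡0 α)) ≤-refl) ,
  K⇒IsP {1 , 3 * β} (subst (λ v → 1 + v ≤ 1) (sym (3*n%3≡0 β)) ≤-refl)
  where
  3*n%3≡0 : ∀ n → 3 * n % 3 ≡ 0
  3*n%3≡0 n = trans (cong (_% 3) (*-comm 3 n)) (m*n%n≡0 n 3)
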